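{- Let $q>r\ge2$ be integers and let $n:=rq$. If $e$ is an edge of $K_n^r$, then $K_n^r-e$ has a fractional $K_q^r$-decomposition.
   Context: $K_n^r$ is the complete $r$-uniform hypergraph on $n$ vertices, and $K_n^r-e$ is obtained by deleting the edge $e$ (keeping all vertices). A fractional $K_q^r$-decomposition of an $r$-uniform hypergraph $G$ is an assignment of non-negative real weights to the copies of $K_q^r$ in $G$ such that for every edge $f$ of $G$, the total weight of copies containing $f$ is exactly $1$. -}

module Defs where

open import Data.Nat using (ℕ; zero; suc)
open import Data.Fin.Subset using (Subset; _⊆_; ∣_∣; inside; outside)
open import Data.Fin.Subset.Properties using (_⊆?_)
open import Data.Vec using (_∷_; [])
open import Data.Rational using (ℚ; 0ℚ; 1ℚ; _+_; _≤_)
open import Data.Product using (Σ; _×_)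
open import Relation.Nullary using (¬_; yes; no)
open import Relation.Binary.PropositionalEquality using (_≡_)

Hypergraph : ℕ → Set₁
Hypergraph n = Subset n → Set

K-minus : (n r : ℕ) → Subset n → Hypergraph n
K-minus n r e f = (∣ f ∣ ≡ r) × ¬ (f ≡ e)

-- A copy of K_q^r in the r-uniform hypergraph G is (determined by) a q-set Q
-- of vertices all of whose r-subsets are edges of G.
IsCopy : {n : ℕ} (r q : ℕ) → Hypergraph n → Subset n → Set
IsCopy r q G Q = (∣ Q ∣ ≡ q) × (∀ f → f ⊆ Q → ∣ f ∣ ≡ r → G f)

sumSubsets : (n : ℕ) → (Subset n → ℚ) → ℚ
sumSubsets zero    g = g []
sumSubsets (suc n) g = sumSubsets n (λ s → g (outside ∷ s)) + sumSubsets n (λ s → g (inside ∷ s))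

weightAt : {n : ℕ} → (Subset n → ℚ) → Subset n → ℚ
weightAt {n} w f = sumSubsets n (λ Q → contrib Q)
  where
  contrib : Subset _ → ℚ
  contrib Q with f ⊆? Q
  ... | yes _ = w Q
  ... | no  _ = 0ℚ

-- Fractional K_q^r-decomposition of G: a weighting of the copies of K_q^r in G
-- (a weight function on vertex subsets vanishing outside the copies) with
-- non-negative weights such that every edge receives total weight exactly 1.
FractionalDecomposition : {n : ℕ} (r q : ℕ) → Hypergraph n → Set
FractionalDecomposition {n} r q G =
  Σ (Subset n → ℚ) λ w →
    (∀ Q → 0ℚ ≤ w Q) ×
    (∀ Q → ¬ (w Q ≡ 0ℚ) → IsCopy r q G Q) ×
    (∀ f → G f → weightAt w f ≡ 1ℚ)

{-# OPTIONS --safe #-}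
-- Give each q-set Q the weight w(∣e ─ Q∣), where b = q − r − 1, u = n − q and
--   w(m) = (1 − (−1)^m C(b + m, m) / C(u, m)) / C(n − r, q − r).
-- Then w(0) = 0, so no copy of K_q^r containing e is used, and w ≥ 0 since b + r ≤ u (as n ≥ 2q − 1).
-- For an edge f ≠ e let k = ∣e ─ f∣ ≥ 1. The q-sets Q ⊇ f missing t points of e ─ f contribute
-- Σ_t C(k, t) C(n − r − k, q − r − k + t) w(t). The constant part of w contributes 1 by Vandermonde's
-- identity. In the alternating part, C(n − r − k, q − r − k + t) C(b + t, t) / C(u, t) is a constant
-- multiple of the falling factorial (t + b) ↓ (k − 1), a polynomial of degree k − 1 in t, so its k-th
-- finite difference vanishes.
module Submission where

open import Defs
open import Data.Nat.Base as ℕ using (ℕ; zero; suc; s≤s; _!)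
open import Data.Fin.Subset using (Subset; inside; outside; ∣_∣; _─_; _∪_; ∁; _⊆_)
open import Data.Fin.Subset.Properties using (_⊆?_)
open import Data.Bool using (true; false; if_then_else_)
open import Data.Product using (_,_)
open import Relation.Nullary using (Dec; does; yes; no; ¬_; contradiction)
open import Relation.Binary.PropositionalEquality

module _ where
  open import Data.Nat
  open import Data.Nat.Properties
  open import Data.Nat.Combinatorics using (_C_; nCk≡n!/k![n-k]!; k![n∸k]!∣n!)
  open import Data.Nat.DivMod using (m/n*n≡m)
  open import Data.Nat.Solver using (module +-*-Solver)
  open +-*-Solver
  open import Function.Base using (_∘_)
  open ≤-Reasoning

  -- The falling factorial; the library's _P_ is defined through division.
  infixl 8 _↓_
  _↓_ : ℕ → ℕ → ℕ
  u ↓ zero  = 1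
  u ↓ suc j = u * pred u ↓ j

  <⇒↓≡0 : ∀ {u j} → u < j → u ↓ j ≡ 0
  <⇒↓≡0 {zero}  {suc j} _         = refl
  <⇒↓≡0 {suc u} {suc j} (s≤s u<j) = trans (cong (suc u *_) (<⇒↓≡0 u<j)) (*-zeroʳ (suc u))

  ↓-monoˡ-≤ : ∀ {u v} t → u ≤ v → u ↓ t ≤ v ↓ t
  ↓-monoˡ-≤ zero    u≤v = ≤-refl
  ↓-monoˡ-≤ (suc t) u≤v = *-mono-≤ u≤v (↓-monoˡ-≤ t (pred-mono-≤ u≤v))

  ≤⇒↓≢0 : ∀ {u t} → t ≤ u → NonZero (u ↓ t)
  ≤⇒↓≢0 {u}     {zero}  _         = _
  ≤⇒↓≢0 {suc u} {suc t} (s≤s t≤u) = m*n≢0 (suc u) (u ↓ t)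
    where instance _ = ≤⇒↓≢0 t≤u

  u↓t*[u∸t]↓s≡u↓[t+s] : ∀ u t s → u ↓ t * (u ∸ t) ↓ s ≡ u ↓ (t + s)
  u↓t*[u∸t]↓s≡u↓[t+s] u       zero    s = *-identityˡ (u ↓ s)
  u↓t*[u∸t]↓s≡u↓[t+s] zero    (suc t) s = refl
  u↓t*[u∸t]↓s≡u↓[t+s] (suc u) (suc t) s = begin-equality
    suc u * u ↓ t * (u ∸ t) ↓ s   ≡⟨ *-assoc (suc u) (u ↓ t) ((u ∸ t) ↓ s) ⟩
    suc u * (u ↓ t * (u ∸ t) ↓ s) ≡⟨ cong (suc u *_) (u↓t*[u∸t]↓s≡u↓[t+s] u t s) ⟩
    suc u * u ↓ (t + s)           ∎

  [j+x]!≡[j+x]↓j*x! : ∀ j x → (j + x) ! ≡ (j + x) ↓ j * x !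
  [j+x]!≡[j+x]↓j*x! zero    x = sym (+-identityʳ (x !))
  [j+x]!≡[j+x]↓j*x! (suc j) x = begin-equality
    suc (j + x) * (j + x) !                ≡⟨ cong (suc (j + x) *_) ([j+x]!≡[j+x]↓j*x! j x) ⟩
    suc (j + x) * ((j + x) ↓ j * x !)      ≡⟨ *-assoc (suc (j + x)) ((j + x) ↓ j) (x !) ⟨
    suc (j + x) * (j + x) ↓ j * x !        ∎

  u↓[1+j]+j*u↓j≡u*u↓j : ∀ u j → u ↓ suc j + j * u ↓ j ≡ u * u ↓ j
  u↓[1+j]+j*u↓j≡u*u↓j u       zero    = +-identityʳ (u * 1)
  u↓[1+j]+j*u↓j≡u*u↓j zero    (suc j) = *-zeroʳ (suc j)
  u↓[1+j]+j*u↓j≡u*u↓j (suc u) (suc j) = begin-equality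
    suc u * a + suc j * (suc u * b)
      ≡⟨ solve 4 (λ u j a b → (con 1 :+ u) :* a :+ (con 1 :+ j) :* ((con 1 :+ u) :* b)
                            := (con 1 :+ u) :* ((a :+ j :* b) :+ b)) refl u j a b ⟩
    suc u * ((a + j * b) + b)        ≡⟨ cong (λ z → suc u * (z + b)) (u↓[1+j]+j*u↓j≡u*u↓j u j) ⟩
    suc u * (u * b + b)              ≡⟨ cong (suc u *_) (+-comm (u * b) b) ⟩
    suc u * (suc u * b)              ∎
    where
    a = u ↓ suc j
    b = u ↓ j

  [1+u]↓[1+j]≡u↓[1+j]+[1+j]*u↓j : ∀ u j → suc u ↓ suc j ≡ u ↓ suc j + suc j * u ↓ j
  [1+u]↓[1+j]≡u↓[1+j]+[1+j]*u↓j u j = begin-equality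
    u ↓ j + u * u ↓ j                     ≡⟨ cong (u ↓ j +_) (u↓[1+j]+j*u↓j≡u*u↓j u j) ⟨
    u ↓ j + (u ↓ suc j + j * u ↓ j)
      ≡⟨ solve 3 (λ b a j → b :+ (a :+ j :* b) := a :+ (con 1 :+ j) :* b) refl (u ↓ j) (u ↓ suc j) j ⟩
    u ↓ suc j + suc j * u ↓ j             ∎

  [x+y]Cx*[x!*y!]≡[x+y]! : ∀ x y → ((x + y) C x) * (x ! * y !) ≡ (x + y) !
  [x+y]Cx*[x!*y!]≡[x+y]! x y = begin-equality
    ((x + y) C x) * (x ! * y !)               ≡⟨ cong (λ z → ((x + y) C x) * (x ! * z !)) (m+n∸m≡n x y) ⟨
    ((x + y) C x) * (x ! * (x + y ∸ x) !)     ≡⟨ cong (_* (x ! * (x + y ∸ x) !)) (nCk≡n!/k![n-k]! x≤x+y) ⟩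
    (x + y) ! / (x ! * (x + y ∸ x) !) * (x ! * (x + y ∸ x) !)  ≡⟨ m/n*n≡m (k![n∸k]!∣n! x≤x+y) ⟩
    (x + y) !                               ∎
    where
    x≤x+y = m≤m+n x y
    instance _ = x !* (x + y ∸ x) !≢0

  [x+y]Cx≢0 : ∀ x y → NonZero ((x + y) C x)
  [x+y]Cx≢0 x y = ≢-nonZero λ C≡0 → ≢-nonZero⁻¹ ((x + y) !) {{(x + y) !≢0}} (begin-equality
    (x + y) !                    ≡⟨ [x+y]Cx*[x!*y!]≡[x+y]! x y ⟨
    ((x + y) C x) * (x ! * y !)  ≡⟨ cong (_* (x ! * y !)) C≡0 ⟩
    0                            ∎)

  -- Both sides equal d ! · u ↓ r · (t + b) ! / x !.
  C*↓-identity : ∀ {b d u r x y t s j} → d ≡ x + y → u ≡ t + y → r ≡ t + s → t + b ≡ j + x →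
    (d C x) * ((t + b) ↓ t * y ↓ s) * (b ! * u !) ≡ d ! * u ↓ r * (t + b) ↓ j
  C*↓-identity {b} {x = x} {y} {t} {s} {j} refl refl refl t+b≡j+x = begin-equality
    K * (T * Y) * (b ! * (t + y) !)
      ≡⟨ cong (λ z → K * (T * Y) * (b ! * z)) ([j+x]!≡[j+x]↓j*x! t y) ⟩
    K * (T * Y) * (b ! * (U * y !))
      ≡⟨ solve 6 (λ K T Y b! U y! → K :* (T :* Y) :* (b! :* (U :* y!)) := T :* b! :* (K :* y! :* (U :* Y)))
                 refl K T Y (b !) U (y !) ⟩
    T * b ! * (K * y ! * (U * Y))
      ≡⟨ cong (_* (K * y ! * (U * Y))) [t+b]! ⟩
    (t + b) ↓ j * x ! * (K * y ! * (U * Y))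
      ≡⟨ solve 6 (λ J x! K y! U Y → J :* x! :* (K :* y! :* (U :* Y)) := K :* (x! :* y!) :* (U :* Y) :* J)
                 refl ((t + b) ↓ j) (x !) K (y !) U Y ⟩
    K * (x ! * y !) * (U * Y) * (t + b) ↓ j
      ≡⟨ cong₂ (λ z w → z * w * (t + b) ↓ j) ([x+y]Cx*[x!*y!]≡[x+y]! x y) U*Y ⟩
    (x + y) ! * (t + y) ↓ (t + s) * (t + b) ↓ j
      ∎
    where
    K = (x + y) C x
    T = (t + b) ↓ t
    U = (t + y) ↓ t
    Y = y ↓ s
    [t+b]! : T * b ! ≡ (t + b) ↓ j * x !
    [t+b]! = begin-equality
      T * b !            ≡⟨ [j+x]!≡[j+x]↓j*x! t b ⟨
      (t + b) !          ≡⟨ subst (λ m → m ! ≡ m ↓ j * x !) (sym t+b≡j+x) ([j+x]!≡[j+x]↓j*x! j x) ⟩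
      (t + b) ↓ j * x !  ∎
    U*Y : U * Y ≡ (t + y) ↓ (t + s)
    U*Y = trans (cong (λ z → U * z ↓ s) (sym (m+n∸m≡n t y))) (u↓t*[u∸t]↓s≡u↓[t+s] (t + y) t s)

  -- τ b u r t = u ↓ r · C(t + b, t) / C(u, t): the correction term of the weights, scaled by u ↓ r.
  τ : ℕ → ℕ → ℕ → ℕ → ℕ
  τ b u r t = (t + b) ↓ t * (u ∸ t) ↓ (r ∸ t)

  τ-0 : ∀ b u r → τ b u r 0 ≡ u ↓ r
  τ-0 b u r = *-identityˡ (u ↓ r)

  τ≤u↓r : ∀ {b u r t} → t ≤ r → r + b ≤ u → τ b u r t ≤ u ↓ r
  τ≤u↓r {b} {u} {r} {t} t≤r r+b≤u = begin
    (t + b) ↓ t * (u ∸ t) ↓ (r ∸ t)  ≤⟨ *-monoˡ-≤ ((u ∸ t) ↓ (r ∸ t)) (↓-monoˡ-≤ t t+b≤u) ⟩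
    u ↓ t * (u ∸ t) ↓ (r ∸ t)        ≡⟨ u↓t*[u∸t]↓s≡u↓[t+s] u t (r ∸ t) ⟩
    u ↓ (t + (r ∸ t))                ≡⟨ cong (u ↓_) (m+[n∸m]≡n t≤r) ⟩
    u ↓ r                            ∎
    where t+b≤u = ≤-trans (+-monoˡ-≤ b t≤r) r+b≤u

  C*τ-identity : ∀ {b u r d c t x j} → t ≤ r → r ≤ u → c + t ≡ suc j → suc j + d ≡ suc b + u → c + x ≡ suc b →
    (d C x) * τ b u r t * (b ! * u !) ≡ d ! * u ↓ r * (t + b) ↓ j
  C*τ-identity {b} {u} {r} {d} {c} {t} {x} {j} t≤r r≤u c+t≡1+j 1+j+d≡1+b+u c+x≡1+b =
    C*↓-identity {b} {x = x} {u ∸ t} {t} {r ∸ t} {j}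
      d≡x+[u∸t] (sym (m+[n∸m]≡n t≤u)) (sym (m+[n∸m]≡n t≤r)) t+b≡j+x
    where
    t≤u = ≤-trans t≤r r≤u
    t+b≡j+x : t + b ≡ j + x
    t+b≡j+x = suc-injective (begin-equality
      suc (t + b)  ≡⟨ +-suc t b ⟨
      t + suc b    ≡⟨ cong (t +_) c+x≡1+b ⟨
      t + (c + x)  ≡⟨ solve 3 (λ t c x → t :+ (c :+ x) := (c :+ t) :+ x) refl t c x ⟩
      c + t + x    ≡⟨ cong (_+ x) c+t≡1+j ⟩
      suc j + x    ∎)
    d≡x+[u∸t] : d ≡ x + (u ∸ t)
    d≡x+[u∸t] = +-cancelˡ-≡ (c + t) d (x + (u ∸ t)) (begin-equality
      c + t + d              ≡⟨ cong (_+ d) c+t≡1+j ⟩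
      suc j + d              ≡⟨ 1+j+d≡1+b+u ⟩
      suc b + u              ≡⟨ cong₂ _+_ c+x≡1+b (m+[n∸m]≡n t≤u) ⟨
      c + x + (t + (u ∸ t))
        ≡⟨ solve 4 (λ c x t y → c :+ x :+ (t :+ y) := c :+ t :+ (x :+ y)) refl c x t (u ∸ t) ⟩
      c + t + (x + (u ∸ t))  ∎)

  1+b<c⇒[t+b]↓j≡0 : ∀ {b c t j} → suc b < c → c + t ≡ suc j → (t + b) ↓ j ≡ 0
  1+b<c⇒[t+b]↓j≡0 {b} {c} {t} {j} 1+b<c c+t≡1+j = <⇒↓≡0 (s≤s⁻¹ (begin
    suc (suc (t + b))  ≡⟨ cong (suc ∘ suc) (+-comm t b) ⟩
    suc (suc b) + t    ≤⟨ +-monoˡ-≤ t 1+b<c ⟩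
    c + t              ≡⟨ c+t≡1+j ⟩
    suc j              ∎))

module _ where
  open import Data.Nat.Properties using (_≟_; +-suc; m+[n∸m]≡n; m≤m+n; <⇒≱)
  open import Data.Nat.Combinatorics using (_C_; nCk+nC[k+1]≡[n+1]C[k+1])
  open import Data.Rational using (ℚ; 0ℚ; 1ℚ; _+_; _*_; -_; _-_; 1/_; NonNegative; NonZero; Positive)
  open import Data.Rational.Properties hiding (_≟_)
  open import Data.Rational.Solver using (module +-*-Solver)
  open +-*-Solver
  open import Algebra.Bundles using (Ring; CommutativeMonoid)
  open import Algebra.Properties.CommutativeSemigroup
    (CommutativeMonoid.commutativeSemigroup +-0-commutativeMonoid)
    using () renaming (interchange to +-interchange)
  open import Algebra.Properties.Semiring.Mult (Ring.semiring +-*-ring) using (_×_; ×-homo-+; ×1-homo-*)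
  open import Data.Sum using (_⊎_; inj₁; inj₂)
  open import Relation.Nullary.Decidable using (dec-false)
  open ≡-Reasoning

  fromℕ : ℕ → ℚ
  fromℕ n = n × 1ℚ

  fromℕ-nonNeg : ∀ n → NonNegative (fromℕ n)
  fromℕ-nonNeg zero    = _
  fromℕ-nonNeg (suc n) = nonNeg+nonNeg⇒nonNeg 1ℚ (fromℕ n) {{fromℕ-nonNeg n}}

  fromℕ-pos : ∀ n .{{_ : ℕ.NonZero n}} → Positive (fromℕ n)
  fromℕ-pos (suc n) = pos+nonNeg⇒pos 1ℚ (fromℕ n) {{fromℕ-nonNeg n}}

  fromℕ-∸ : ∀ {m n} → n ℕ.≤ m → fromℕ (m ℕ.∸ n) ≡ fromℕ m - fromℕ n
  fromℕ-∸ {m} {n} n≤m = begin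
    fromℕ (m ℕ.∸ n)
      ≡⟨ solve 2 (λ d n → d := (n :+ d) :- n) refl (fromℕ (m ℕ.∸ n)) (fromℕ n) ⟩
    fromℕ n + fromℕ (m ℕ.∸ n) - fromℕ n ≡⟨ cong (_- fromℕ n) (×-homo-+ 1ℚ n (m ℕ.∸ n)) ⟨
    fromℕ (n ℕ.+ (m ℕ.∸ n)) - fromℕ n   ≡⟨ cong (λ k → fromℕ k - fromℕ n) (m+[n∸m]≡n n≤m) ⟩
    fromℕ m - fromℕ n                   ∎

  p*q≡0⇒p≡0 : ∀ p q .{{_ : NonZero q}} → p * q ≡ 0ℚ → p ≡ 0ℚ
  p*q≡0⇒p≡0 p q pq≡0 = begin
    p                 ≡⟨ *-identityʳ p ⟨
    p * 1ℚ            ≡⟨ cong (p *_) (*-inverseʳ q) ⟨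
    p * (q * 1/ q)    ≡⟨ *-assoc p q (1/ q) ⟨
    p * q * 1/ q      ≡⟨ cong (_* 1/ q) pq≡0 ⟩
    0ℚ * 1/ q         ≡⟨ *-zeroˡ (1/ q) ⟩
    0ℚ                ∎

  [-1]^_ : ℕ → ℚ
  [-1]^ zero  = 1ℚ
  [-1]^ suc t = - [-1]^ t

  [-1]^t≡±1 : ∀ t → [-1]^ t ≡ 1ℚ ⊎ [-1]^ t ≡ - 1ℚ
  [-1]^t≡±1 zero = inj₁ refl
  [-1]^t≡±1 (suc t) with [-1]^t≡±1 t
  ... | inj₁ ≡1  = inj₂ (cong -_ ≡1)
  ... | inj₂ ≡-1 = inj₁ (cong -_ ≡-1)

  m-[-1]^t*n-nonNeg : ∀ {m n} t → n ℕ.≤ m → NonNegative (fromℕ m - [-1]^ t * fromℕ n)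
  m-[-1]^t*n-nonNeg {m} {n} t n≤m with [-1]^t≡±1 t
  ... | inj₁ ≡1 = subst NonNegative (begin
    fromℕ (m ℕ.∸ n)              ≡⟨ fromℕ-∸ n≤m ⟩
    fromℕ m - fromℕ n            ≡⟨ cong (_-_ (fromℕ m)) (*-identityˡ (fromℕ n)) ⟨
    fromℕ m - 1ℚ * fromℕ n       ≡⟨ cong (λ s → fromℕ m - s * fromℕ n) ≡1 ⟨
    fromℕ m - [-1]^ t * fromℕ n  ∎) (fromℕ-nonNeg (m ℕ.∸ n))
  ... | inj₂ ≡-1 = subst NonNegative (begin
    fromℕ (m ℕ.+ n)              ≡⟨ ×-homo-+ 1ℚ m n ⟩
    fromℕ m + fromℕ n            ≡⟨ solve 2 (λ m n → m :+ n := m :- (:- con 1ℚ) :* n) refl (fromℕ m) (fromℕ n) ⟩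
    fromℕ m - - 1ℚ * fromℕ n     ≡⟨ cong (λ s → fromℕ m - s * fromℕ n) ≡-1 ⟨
    fromℕ m - [-1]^ t * fromℕ n  ∎) (fromℕ-nonNeg (m ℕ.+ n))

  𝟙[_] : {P : Set} → Dec P → ℚ
  𝟙[ P? ] = if does P? then 1ℚ else 0ℚ

  𝟙-nonNeg : ∀ {P : Set} (P? : Dec P) → NonNegative 𝟙[ P? ]
  𝟙-nonNeg P? with does P?
  ... | true  = _
  ... | false = _

  ¬⇒𝟙≡0 : ∀ {P : Set} (P? : Dec P) → ¬ P → 𝟙[ P? ] ≡ 0ℚ
  ¬⇒𝟙≡0 P? ¬p = cong (if_then 1ℚ else 0ℚ) (dec-false P? ¬p)

  𝟙[m+n≟m+o]≡𝟙[n≟o] : ∀ m {n o} → 𝟙[ m ℕ.+ n ≟ m ℕ.+ o ] ≡ 𝟙[ n ≟ o ]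
  𝟙[m+n≟m+o]≡𝟙[n≟o] zero    = refl
  𝟙[m+n≟m+o]≡𝟙[n≟o] (suc m) = 𝟙[m+n≟m+o]≡𝟙[n≟o] m

  -- Σ-binomial k H = Σ_{c + t = k} (k choose c) H c t: each of k elements is either
  -- counted by t (first summand) or by c (second summand).
  Σ-binomial : ℕ → (ℕ → ℕ → ℚ) → ℚ
  Σ-binomial zero    H = H 0 0
  Σ-binomial (suc k) H = Σ-binomial k (λ c t → H c (suc t)) + Σ-binomial k (λ c t → H (suc c) t)

  Σ-binomial-cong : ∀ k {H H′ : ℕ → ℕ → ℚ} → (∀ c t → c ℕ.+ t ≡ k → H c t ≡ H′ c t) →
    Σ-binomial k H ≡ Σ-binomial k H′
  Σ-binomial-cong zero    H≡H′ = H≡H′ 0 0 refl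
  Σ-binomial-cong (suc k) H≡H′ = cong₂ _+_
    (Σ-binomial-cong k λ c t c+t≡k → H≡H′ c (suc t) (trans (+-suc c t) (cong suc c+t≡k)))
    (Σ-binomial-cong k λ c t c+t≡k → H≡H′ (suc c) t (cong suc c+t≡k))

  Σ-binomial-0 : ∀ k → Σ-binomial k (λ _ _ → 0ℚ) ≡ 0ℚ
  Σ-binomial-0 zero    = refl
  Σ-binomial-0 (suc k) = cong₂ _+_ (Σ-binomial-0 k) (Σ-binomial-0 k)

  Σ-binomial-+ : ∀ k (H H′ : ℕ → ℕ → ℚ) →
    Σ-binomial k (λ c t → H c t + H′ c t) ≡ Σ-binomial k H + Σ-binomial k H′
  Σ-binomial-+ zero    H H′ = refl
  Σ-binomial-+ (suc k) H H′ = trans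
    (cong₂ _+_ (Σ-binomial-+ k (λ c t → H c (suc t)) (λ c t → H′ c (suc t)))
               (Σ-binomial-+ k (λ c t → H (suc c) t) (λ c t → H′ (suc c) t)))
    (+-interchange (Σ-binomial k (λ c t → H c (suc t))) (Σ-binomial k (λ c t → H′ c (suc t)))
                   (Σ-binomial k (λ c t → H (suc c) t)) (Σ-binomial k (λ c t → H′ (suc c) t)))

  Σ-binomial-*ˡ : ∀ k x (H : ℕ → ℕ → ℚ) → Σ-binomial k (λ c t → x * H c t) ≡ x * Σ-binomial k H
  Σ-binomial-*ˡ zero    x H = refl
  Σ-binomial-*ˡ (suc k) x H = trans
    (cong₂ _+_ (Σ-binomial-*ˡ k x (λ c t → H c (suc t))) (Σ-binomial-*ˡ k x (λ c t → H (suc c) t)))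
    (sym (*-distribˡ-+ x (Σ-binomial k (λ c t → H c (suc t))) (Σ-binomial k (λ c t → H (suc c) t))))

  Σ-binomial-*ʳ : ∀ k x (H : ℕ → ℕ → ℚ) → Σ-binomial k (λ c t → H c t * x) ≡ Σ-binomial k H * x
  Σ-binomial-*ʳ k x H = begin
    Σ-binomial k (λ c t → H c t * x)  ≡⟨ Σ-binomial-cong k (λ c t _ → *-comm (H c t) x) ⟩
    Σ-binomial k (λ c t → x * H c t)  ≡⟨ Σ-binomial-*ˡ k x H ⟩
    x * Σ-binomial k H                ≡⟨ *-comm x (Σ-binomial k H) ⟩
    Σ-binomial k H * x                ∎

  Σ-binomial-vandermonde : ∀ k d (G : ℕ → ℕ → ℚ) →
    Σ-binomial k (λ c t → Σ-binomial d (λ a b → G (c ℕ.+ a) (t ℕ.+ b))) ≡ Σ-binomial (k ℕ.+ d) G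
  Σ-binomial-vandermonde zero    d G = refl
  Σ-binomial-vandermonde (suc k) d G = cong₂ _+_
    (Σ-binomial-vandermonde k d (λ c t → G c (suc t)))
    (Σ-binomial-vandermonde k d (λ c t → G (suc c) t))

  Σ-binomial-𝟙 : ∀ d c x → Σ-binomial d (λ a _ → 𝟙[ c ℕ.+ a ≟ c ℕ.+ x ]) ≡ fromℕ (d C x)
  Σ-binomial-𝟙 zero    zero    zero    = refl
  Σ-binomial-𝟙 zero    zero    (suc x) = refl
  Σ-binomial-𝟙 (suc d) zero    zero    = begin
    Σ-binomial d (λ a _ → 𝟙[ a ≟ 0 ]) + Σ-binomial d (λ _ _ → 0ℚ)
      ≡⟨ cong₂ _+_ (Σ-binomial-𝟙 d 0 0) (Σ-binomial-0 d) ⟩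
    fromℕ 1 + 0ℚ  ≡⟨ +-identityʳ (fromℕ 1) ⟩
    fromℕ 1       ∎
  Σ-binomial-𝟙 (suc d) zero    (suc x) = begin
    Σ-binomial d (λ a _ → 𝟙[ a ≟ suc x ]) + Σ-binomial d (λ a _ → 𝟙[ a ≟ x ])
      ≡⟨ cong₂ _+_ (Σ-binomial-𝟙 d 0 (suc x)) (Σ-binomial-𝟙 d 0 x) ⟩
    fromℕ (d C suc x) + fromℕ (d C x)  ≡⟨ +-comm (fromℕ (d C suc x)) (fromℕ (d C x)) ⟩
    fromℕ (d C x) + fromℕ (d C suc x)  ≡⟨ ×-homo-+ 1ℚ (d C x) (d C suc x) ⟨
    fromℕ (d C x ℕ.+ d C suc x)        ≡⟨ cong fromℕ (nCk+nC[k+1]≡[n+1]C[k+1] d x) ⟩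
    fromℕ (suc d C suc x)              ∎
  Σ-binomial-𝟙 d       (suc c) x       = Σ-binomial-𝟙 d c x

  Σ-binomial-𝟙-< : ∀ d {c y} → y ℕ.< c → Σ-binomial d (λ a _ → 𝟙[ c ℕ.+ a ≟ y ]) ≡ 0ℚ
  Σ-binomial-𝟙-< d {c} {y} y<c = trans
    (Σ-binomial-cong d λ a _ _ → ¬⇒𝟙≡0 (c ℕ.+ a ≟ y) λ c+a≡y → <⇒≱ y<c (subst (c ℕ.≤_) c+a≡y (m≤m+n c a)))
    (Σ-binomial-0 d)

  Σ-binomial-alternating : ∀ k (φ : ℕ → ℚ) →
    Σ-binomial (suc k) (λ _ t → [-1]^ t * φ t) ≡ Σ-binomial k (λ _ t → [-1]^ t * (φ t - φ (suc t)))
  Σ-binomial-alternating k φ = begin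
    Σ-binomial k (λ _ t → - [-1]^ t * φ (suc t)) + Σ-binomial k (λ _ t → [-1]^ t * φ t)
      ≡⟨ +-comm (Σ-binomial k (λ _ t → - [-1]^ t * φ (suc t))) (Σ-binomial k (λ _ t → [-1]^ t * φ t)) ⟩
    Σ-binomial k (λ _ t → [-1]^ t * φ t) + Σ-binomial k (λ _ t → - [-1]^ t * φ (suc t))
      ≡⟨ Σ-binomial-+ k (λ _ t → [-1]^ t * φ t) (λ _ t → - [-1]^ t * φ (suc t)) ⟨
    Σ-binomial k (λ _ t → [-1]^ t * φ t + - [-1]^ t * φ (suc t))
      ≡⟨ Σ-binomial-cong k (λ _ t _ → factor t) ⟩
    Σ-binomial k (λ _ t → [-1]^ t * (φ t - φ (suc t)))
      ∎
    where
    factor : ∀ t → [-1]^ t * φ t + - [-1]^ t * φ (suc t) ≡ [-1]^ t * (φ t - φ (suc t))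
    factor t = solve 3 (λ s x y → s :* x :+ (:- s) :* y := s :* (x :- y)) refl ([-1]^ t) (φ t) (φ (suc t))

  Σ-binomial-alternating-↓ : ∀ {k j} x → j ℕ.< k → Σ-binomial k (λ _ t → [-1]^ t * fromℕ ((t ℕ.+ x) ↓ j)) ≡ 0ℚ
  Σ-binomial-alternating-↓ {suc k} {zero} x _ = begin
    Σ-binomial (suc k) (λ _ t → [-1]^ t * 1ℚ)  ≡⟨ Σ-binomial-alternating k (λ _ → 1ℚ) ⟩
    Σ-binomial k (λ _ t → [-1]^ t * (1ℚ - 1ℚ)) ≡⟨ Σ-binomial-cong k (λ _ t _ → *-zeroʳ ([-1]^ t)) ⟩
    Σ-binomial k (λ _ _ → 0ℚ)                  ≡⟨ Σ-binomial-0 k ⟩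
    0ℚ                                         ∎
  Σ-binomial-alternating-↓ {suc k} {suc j} x (s≤s j<k) = begin
    Σ-binomial (suc k) (λ _ t → [-1]^ t * φ t)
      ≡⟨ Σ-binomial-alternating k φ ⟩
    Σ-binomial k (λ _ t → [-1]^ t * (φ t - φ (suc t)))
      ≡⟨ Σ-binomial-cong k (λ _ t _ → Δφ t) ⟩
    Σ-binomial k (λ _ t → - fromℕ (suc j) * ([-1]^ t * ψ t))
      ≡⟨ Σ-binomial-*ˡ k (- fromℕ (suc j)) (λ _ t → [-1]^ t * ψ t) ⟩
    - fromℕ (suc j) * Σ-binomial k (λ _ t → [-1]^ t * ψ t)
      ≡⟨ cong (- fromℕ (suc j) *_) (Σ-binomial-alternating-↓ x j<k) ⟩
    - fromℕ (suc j) * 0ℚ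
      ≡⟨ *-zeroʳ (- fromℕ (suc j)) ⟩
    0ℚ ∎
    where
    φ ψ : ℕ → ℚ
    φ t = fromℕ ((t ℕ.+ x) ↓ suc j)
    ψ t = fromℕ ((t ℕ.+ x) ↓ j)
    φ-suc : ∀ t → φ (suc t) ≡ φ t + fromℕ (suc j) * ψ t
    φ-suc t = begin
      fromℕ (suc (t ℕ.+ x) ↓ suc j)
        ≡⟨ cong fromℕ ([1+u]↓[1+j]≡u↓[1+j]+[1+j]*u↓j (t ℕ.+ x) j) ⟩
      fromℕ ((t ℕ.+ x) ↓ suc j ℕ.+ suc j ℕ.* (t ℕ.+ x) ↓ j)
        ≡⟨ ×-homo-+ 1ℚ ((t ℕ.+ x) ↓ suc j) (suc j ℕ.* (t ℕ.+ x) ↓ j) ⟩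
      φ t + fromℕ (suc j ℕ.* (t ℕ.+ x) ↓ j)
        ≡⟨ cong (φ t +_) (×1-homo-* (suc j) ((t ℕ.+ x) ↓ j)) ⟩
      φ t + fromℕ (suc j) * ψ t
        ∎
    Δφ : ∀ t → [-1]^ t * (φ t - φ (suc t)) ≡ - fromℕ (suc j) * ([-1]^ t * ψ t)
    Δφ t = begin
      [-1]^ t * (φ t - φ (suc t))                    ≡⟨ cong (λ z → [-1]^ t * (φ t - z)) (φ-suc t) ⟩
      [-1]^ t * (φ t - (φ t + fromℕ (suc j) * ψ t))
        ≡⟨ solve 4 (λ s f J p → s :* (f :- (f :+ J :* p)) := (:- J) :* (s :* p))
                   refl ([-1]^ t) (φ t) (fromℕ (suc j)) (ψ t) ⟩
      - fromℕ (suc j) * ([-1]^ t * ψ t)              ∎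

module _ where
  open import Data.Nat.Base using (_+_; _<_; z<s)
  open import Data.Nat.Properties using (+-suc; +-cancelˡ-≡)
  open import Data.Rational as ℚ using (ℚ; 0ℚ)
  open import Data.Rational.Properties using (+-identityˡ)
  open import Data.Vec using (_∷_; []; here)
  open import Data.Fin.Subset.Properties using (drop-∷-⊆)
  open ≡-Reasoning

  sumSubsets-cong : ∀ n {g h : Subset n → ℚ} → (∀ Q → g Q ≡ h Q) → sumSubsets n g ≡ sumSubsets n h
  sumSubsets-cong zero    g≡h = g≡h []
  sumSubsets-cong (suc n) g≡h = cong₂ ℚ._+_ (sumSubsets-cong n (λ Q → g≡h (outside ∷ Q)))
                                           (sumSubsets-cong n (λ Q → g≡h (inside ∷ Q)))

  sumSubsets-0 : ∀ n → sumSubsets n (λ _ → 0ℚ) ≡ 0ℚ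
  sumSubsets-0 zero    = refl
  sumSubsets-0 (suc n) = cong₂ ℚ._+_ (sumSubsets-0 n) (sumSubsets-0 n)

  -- The summand of weightAt is defined in an anonymous where-block, so it can
  -- only be named through the metavariable below, solved from its use in weightAt-≡.
  mutual
    weightAt-≡ : ∀ {n} (w : Subset n → ℚ) f →
      weightAt w f ≡ sumSubsets n (λ Q → if does (f ⊆? Q) then w Q else 0ℚ)
    weightAt-≡ {n} w f = sumSubsets-cong n (weightAt-summand-≡ w f)

    weightAt-summand-≡ : ∀ {n} (w : Subset n → ℚ) f Q → _ ≡ (if does (f ⊆? Q) then w Q else 0ℚ)
    weightAt-summand-≡ w f Q with f ⊆? Q
    ... | yes _ = refl
    ... | no  _ = refl

  -- A set Q ⊇ f is f together with c of the ∣ e ─ f ∣ points of e ─ f (missing the other t)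
  -- and a of the ∣ ∁ (e ∪ f) ∣ points outside e ∪ f.
  sumSubsets-⊇ : ∀ {n} (e f : Subset n) (G : ℕ → ℕ → ℚ) →
    sumSubsets n (λ Q → if does (f ⊆? Q) then G ∣ Q ∣ ∣ e ─ Q ∣ else 0ℚ) ≡
    Σ-binomial ∣ e ─ f ∣ (λ c t → Σ-binomial ∣ ∁ (e ∪ f) ∣ (λ a _ → G (∣ f ∣ + (c + a)) t))
  sumSubsets-⊇ [] [] G = refl
  sumSubsets-⊇ {suc n} (inside ∷ e) (inside ∷ f) G =
    trans (cong₂ ℚ._+_ (sumSubsets-0 n) (sumSubsets-⊇ e f (λ s → G (suc s)))) (+-identityˡ _)
  sumSubsets-⊇ {suc n} (outside ∷ e) (inside ∷ f) G =
    trans (cong₂ ℚ._+_ (sumSubsets-0 n) (sumSubsets-⊇ e f (λ s → G (suc s)))) (+-identityˡ _)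
  sumSubsets-⊇ (inside ∷ e) (outside ∷ f) G = cong₂ ℚ._+_
    (sumSubsets-⊇ e f (λ s m → G s (suc m)))
    (trans (sumSubsets-⊇ e f (λ s → G (suc s)))
           (Σ-binomial-cong ∣ e ─ f ∣ λ c t _ → Σ-binomial-cong ∣ ∁ (e ∪ f) ∣ λ a _ _ →
              cong (λ s → G s t) (sym (+-suc ∣ f ∣ (c + a)))))
  sumSubsets-⊇ (outside ∷ e) (outside ∷ f) G = trans
    (cong₂ ℚ._+_
      (sumSubsets-⊇ e f G)
      (trans (sumSubsets-⊇ e f (λ s → G (suc s)))
             (Σ-binomial-cong ∣ e ─ f ∣ λ c t _ → Σ-binomial-cong ∣ ∁ (e ∪ f) ∣ λ a _ _ →
                cong (λ s → G s t) (sym (trans (cong (∣ f ∣ +_) (+-suc c a)) (+-suc ∣ f ∣ (c + a)))))))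
    (sym (Σ-binomial-+ ∣ e ─ f ∣ _ _))

  ∣f∣+∣e─f∣+∣∁[e∪f]∣≡n : ∀ {n} (e f : Subset n) → ∣ f ∣ + ∣ e ─ f ∣ + ∣ ∁ (e ∪ f) ∣ ≡ n
  ∣f∣+∣e─f∣+∣∁[e∪f]∣≡n []            []            = refl
  ∣f∣+∣e─f∣+∣∁[e∪f]∣≡n (inside  ∷ e) (inside  ∷ f) = cong suc (∣f∣+∣e─f∣+∣∁[e∪f]∣≡n e f)
  ∣f∣+∣e─f∣+∣∁[e∪f]∣≡n (outside ∷ e) (inside  ∷ f) = cong suc (∣f∣+∣e─f∣+∣∁[e∪f]∣≡n e f)
  ∣f∣+∣e─f∣+∣∁[e∪f]∣≡n (inside  ∷ e) (outside ∷ f) =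
    trans (cong (_+ ∣ ∁ (e ∪ f) ∣) (+-suc ∣ f ∣ ∣ e ─ f ∣)) (cong suc (∣f∣+∣e─f∣+∣∁[e∪f]∣≡n e f))
  ∣f∣+∣e─f∣+∣∁[e∪f]∣≡n (outside ∷ e) (outside ∷ f) =
    trans (+-suc (∣ f ∣ + ∣ e ─ f ∣) ∣ ∁ (e ∪ f) ∣) (cong suc (∣f∣+∣e─f∣+∣∁[e∪f]∣≡n e f))

  ∣e∣+∣f─e∣≡∣f∣+∣e─f∣ : ∀ {n} (e f : Subset n) → ∣ e ∣ + ∣ f ─ e ∣ ≡ ∣ f ∣ + ∣ e ─ f ∣
  ∣e∣+∣f─e∣≡∣f∣+∣e─f∣ []            []            = refl
  ∣e∣+∣f─e∣≡∣f∣+∣e─f∣ (inside  ∷ e) (inside  ∷ f) = cong suc (∣e∣+∣f─e∣≡∣f∣+∣e─f∣ e f)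
  ∣e∣+∣f─e∣≡∣f∣+∣e─f∣ (outside ∷ e) (outside ∷ f) = ∣e∣+∣f─e∣≡∣f∣+∣e─f∣ e f
  ∣e∣+∣f─e∣≡∣f∣+∣e─f∣ (inside  ∷ e) (outside ∷ f) =
    trans (cong suc (∣e∣+∣f─e∣≡∣f∣+∣e─f∣ e f)) (sym (+-suc ∣ f ∣ ∣ e ─ f ∣))
  ∣e∣+∣f─e∣≡∣f∣+∣e─f∣ (outside ∷ e) (inside  ∷ f) =
    trans (+-suc ∣ e ∣ ∣ f ─ e ∣) (cong suc (∣e∣+∣f─e∣≡∣f∣+∣e─f∣ e f))

  ∣e─f∣≡0⇒∣f─e∣≡0⇒e≡f : ∀ {n} (e f : Subset n) → ∣ e ─ f ∣ ≡ 0 → ∣ f ─ e ∣ ≡ 0 → e ≡ f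
  ∣e─f∣≡0⇒∣f─e∣≡0⇒e≡f []            []            _  _  = refl
  ∣e─f∣≡0⇒∣f─e∣≡0⇒e≡f (inside  ∷ e) (inside  ∷ f) p  q  = cong (inside ∷_) (∣e─f∣≡0⇒∣f─e∣≡0⇒e≡f e f p q)
  ∣e─f∣≡0⇒∣f─e∣≡0⇒e≡f (outside ∷ e) (outside ∷ f) p  q  = cong (outside ∷_) (∣e─f∣≡0⇒∣f─e∣≡0⇒e≡f e f p q)
  ∣e─f∣≡0⇒∣f─e∣≡0⇒e≡f (inside  ∷ e) (outside ∷ f) () _
  ∣e─f∣≡0⇒∣f─e∣≡0⇒e≡f (outside ∷ e) (inside  ∷ f) _  ()

  0<∣e─f∣ : ∀ {n} (e f : Subset n) → ∣ e ∣ ≡ ∣ f ∣ → f ≢ e → 0 < ∣ e ─ f ∣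
  0<∣e─f∣ e f ∣e∣≡∣f∣ f≢e with ∣ e ─ f ∣ in ∣e─f∣≡k
  ... | suc _ = z<s
  ... | zero  = contradiction (sym (∣e─f∣≡0⇒∣f─e∣≡0⇒e≡f e f ∣e─f∣≡k ∣f─e∣≡0)) f≢e
    where
    ∣f─e∣≡0 : ∣ f ─ e ∣ ≡ 0
    ∣f─e∣≡0 = +-cancelˡ-≡ ∣ e ∣ ∣ f ─ e ∣ 0 (begin
      ∣ e ∣ + ∣ f ─ e ∣  ≡⟨ ∣e∣+∣f─e∣≡∣f∣+∣e─f∣ e f ⟩
      ∣ f ∣ + ∣ e ─ f ∣  ≡⟨ cong₂ _+_ (sym ∣e∣≡∣f∣) ∣e─f∣≡k ⟩
      ∣ e ∣ + 0          ∎)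

  ⊆⇒∣─∣≡0 : ∀ {n} (e Q : Subset n) → e ⊆ Q → ∣ e ─ Q ∣ ≡ 0
  ⊆⇒∣─∣≡0 []            []            _   = refl
  ⊆⇒∣─∣≡0 (inside  ∷ e) (outside ∷ Q) e⊆Q with () ← e⊆Q here
  ⊆⇒∣─∣≡0 (inside  ∷ e) (inside  ∷ Q) e⊆Q = ⊆⇒∣─∣≡0 e Q (drop-∷-⊆ e⊆Q)
  ⊆⇒∣─∣≡0 (outside ∷ e) (outside ∷ Q) e⊆Q = ⊆⇒∣─∣≡0 e Q (drop-∷-⊆ e⊆Q)
  ⊆⇒∣─∣≡0 (outside ∷ e) (inside  ∷ Q) e⊆Q = ⊆⇒∣─∣≡0 e Q (drop-∷-⊆ e⊆Q)

module Decomposition (r b u : ℕ) (r+b≤u : r ℕ.+ b ℕ.≤ u) where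

  open import Data.Nat.Properties as ℕ using (_≟_)
  open import Data.Nat.Combinatorics using (_C_)
  open import Data.Rational using (ℚ; 0ℚ; 1ℚ; _+_; _*_; -_; _-_; 1/_; _≤_; NonNegative; NonZero; Positive)
  open import Data.Rational.Properties hiding (_≟_)
  open import Data.Rational.Solver using (module +-*-Solver)
  open +-*-Solver
  open import Algebra.Bundles using (Ring)
  open import Algebra.Properties.Semiring.Mult (Ring.semiring +-*-ring) using (×1-homo-*)
  open import Data.Fin.Subset.Properties using (∣p─q∣≤∣p∣)
  open import Relation.Nullary.Decidable using (decidable-stable)
  open ≡-Reasoning

  q n A M : ℕ
  q = suc (r ℕ.+ b)
  n = q ℕ.+ u
  A = suc b ℕ.+ u
  M = u ↓ r

  r≤u : r ℕ.≤ u
  r≤u = ℕ.≤-trans (ℕ.m≤m+n r b) r+b≤u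

  D : ℚ
  D = fromℕ ((A C suc b) ℕ.* M)

  instance
    D>0 : Positive D
    D>0 = fromℕ-pos ((A C suc b) ℕ.* M) {{ℕ.m*n≢0 (A C suc b) M}}
      where
      instance
        _ = [x+y]Cx≢0 (suc b) u
        _ = ≤⇒↓≢0 r≤u

    D≢0 : NonZero D
    D≢0 = pos⇒nonZero D

  T : ℕ → ℚ
  T t = fromℕ (τ b u r t)

  X : ℕ → ℚ
  X t = (fromℕ M - [-1]^ t * T t) * 1/ D

  X-nonNeg : ∀ {t} → t ℕ.≤ r → NonNegative (X t)
  X-nonNeg {t} t≤r = nonNeg*nonNeg⇒nonNeg (fromℕ M - [-1]^ t * T t) (1/ D)
    where
    instance
      _ = m-[-1]^t*n-nonNeg t (τ≤u↓r t≤r r+b≤u)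
      _ = pos⇒nonNeg (1/ D) {{1/pos⇒pos D}}

  X-0 : X 0 ≡ 0ℚ
  X-0 = begin
    (fromℕ M - 1ℚ * T 0) * 1/ D
      ≡⟨ cong (λ m → (fromℕ M - 1ℚ * fromℕ m) * 1/ D) (τ-0 b u r) ⟩
    (fromℕ M - 1ℚ * fromℕ M) * 1/ D
      ≡⟨ solve 2 (λ m i → (m :- con 1ℚ :* m) :* i := con 0ℚ) refl (fromℕ M) (1/ D) ⟩
    0ℚ
      ∎

  module _ (e : Subset n) (∣e∣≡r : ∣ e ∣ ≡ r) where

    weight : Subset n → ℚ
    weight Q = 𝟙[ ∣ Q ∣ ≟ q ] * X ∣ e ─ Q ∣

    weight-nonNeg : ∀ Q → 0ℚ ≤ weight Q
    weight-nonNeg Q = nonNegative⁻¹ (weight Q) {{nonNeg*nonNeg⇒nonNeg 𝟙[ ∣ Q ∣ ≟ q ] (X ∣ e ─ Q ∣)}}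
      where
      instance
        _ = 𝟙-nonNeg (∣ Q ∣ ≟ q)
        _ = X-nonNeg (subst (∣ e ─ Q ∣ ℕ.≤_) ∣e∣≡r (∣p─q∣≤∣p∣ e Q))

    weight≢0⇒IsCopy : ∀ Q → weight Q ≢ 0ℚ → IsCopy r q (K-minus n r e) Q
    weight≢0⇒IsCopy Q w≢0 = ∣Q∣≡q , λ f f⊆Q ∣f∣≡r → ∣f∣≡r , λ f≡e → w≢0 (e⊆Q⇒weight≡0 (subst (_⊆ Q) f≡e f⊆Q))
      where
      ∣Q∣≡q : ∣ Q ∣ ≡ q
      ∣Q∣≡q = decidable-stable (∣ Q ∣ ≟ q) λ ∣Q∣≢q →
        w≢0 (trans (cong (_* X ∣ e ─ Q ∣) (¬⇒𝟙≡0 (∣ Q ∣ ≟ q) ∣Q∣≢q)) (*-zeroˡ (X ∣ e ─ Q ∣)))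
      e⊆Q⇒weight≡0 : e ⊆ Q → weight Q ≡ 0ℚ
      e⊆Q⇒weight≡0 e⊆Q = begin
        𝟙[ ∣ Q ∣ ≟ q ] * X ∣ e ─ Q ∣  ≡⟨ cong (λ m → 𝟙[ ∣ Q ∣ ≟ q ] * X m) (⊆⇒∣─∣≡0 e Q e⊆Q) ⟩
        𝟙[ ∣ Q ∣ ≟ q ] * X 0          ≡⟨ cong (𝟙[ ∣ Q ∣ ≟ q ] *_) X-0 ⟩
        𝟙[ ∣ Q ∣ ≟ q ] * 0ℚ           ≡⟨ *-zeroʳ 𝟙[ ∣ Q ∣ ≟ q ] ⟩
        0ℚ                            ∎

    module _ (f : Subset n) (∣f∣≡r : ∣ f ∣ ≡ r) (f≢e : f ≢ e) where

      k d j K L : ℕ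
      k = ∣ e ─ f ∣
      d = ∣ ∁ (e ∪ f) ∣
      j = ℕ.pred k
      K = b ! ℕ.* u !
      L = d ! ℕ.* M

      instance
        k≢0 : ℕ.NonZero k
        k≢0 = ℕ.>-nonZero (0<∣e─f∣ e f (trans ∣e∣≡r (sym ∣f∣≡r)) f≢e)

      1+j≡k : suc j ≡ k
      1+j≡k = ℕ.suc-pred k

      k≤r : k ℕ.≤ r
      k≤r = subst (k ℕ.≤_) ∣e∣≡r (∣p─q∣≤∣p∣ e f)

      k+d≡A : k ℕ.+ d ≡ A
      k+d≡A = ℕ.+-cancelˡ-≡ r (k ℕ.+ d) A (begin
        r ℕ.+ (k ℕ.+ d)      ≡⟨ ℕ.+-assoc r k d ⟨
        r ℕ.+ k ℕ.+ d        ≡⟨ cong (λ m → m ℕ.+ k ℕ.+ d) ∣f∣≡r ⟨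
        ∣ f ∣ ℕ.+ k ℕ.+ d    ≡⟨ ∣f∣+∣e─f∣+∣∁[e∪f]∣≡n e f ⟩
        suc (r ℕ.+ b) ℕ.+ u  ≡⟨ cong (ℕ._+ u) (ℕ.+-suc r b) ⟨
        r ℕ.+ suc b ℕ.+ u    ≡⟨ ℕ.+-assoc r (suc b) u ⟩
        r ℕ.+ A              ∎)

      Z P : ℕ → ℚ
      Z c = Σ-binomial d (λ a _ → 𝟙[ c ℕ.+ a ≟ suc b ])
      P t = fromℕ ((t ℕ.+ b) ↓ j)

      Z*T : ∀ c t → c ℕ.+ t ≡ k → Z c * T t * fromℕ K ≡ fromℕ L * P t
      Z*T c t c+t≡k with c ℕ.≤? suc b
      ... | yes c≤1+b with ℕ.m≤n⇒∃[o]m+o≡n c≤1+b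
      ...   | x , c+x≡1+b = begin
        Z c * T t * fromℕ K
          ≡⟨ cong (λ z → z * T t * fromℕ K) Z≡dCx ⟩
        fromℕ (d C x) * T t * fromℕ K
          ≡⟨ trans (×1-homo-* ((d C x) ℕ.* τ b u r t) K) (cong (_* fromℕ K) (×1-homo-* (d C x) (τ b u r t))) ⟨
        fromℕ ((d C x) ℕ.* τ b u r t ℕ.* K)
          ≡⟨ cong fromℕ (C*τ-identity t≤r r≤u c+t≡1+j 1+j+d≡A c+x≡1+b) ⟩
        fromℕ (L ℕ.* (t ℕ.+ b) ↓ j)
          ≡⟨ ×1-homo-* L ((t ℕ.+ b) ↓ j) ⟩
        fromℕ L * P t
          ∎
        where
        t≤r = ℕ.≤-trans (ℕ.m≤n+m t c) (ℕ.≤-trans (ℕ.≤-reflexive c+t≡k) k≤r)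
        c+t≡1+j = trans c+t≡k (sym 1+j≡k)
        1+j+d≡A = trans (cong (ℕ._+ d) 1+j≡k) k+d≡A
        Z≡dCx : Z c ≡ fromℕ (d C x)
        Z≡dCx = subst (λ y → Σ-binomial d (λ a _ → 𝟙[ c ℕ.+ a ≟ y ]) ≡ fromℕ (d C x))
                      c+x≡1+b (Σ-binomial-𝟙 d c x)
      Z*T c t c+t≡k | no c≰1+b = begin
        Z c * T t * fromℕ K  ≡⟨ cong (λ z → z * T t * fromℕ K) (Σ-binomial-𝟙-< d 1+b<c) ⟩
        0ℚ * T t * fromℕ K   ≡⟨ trans (cong (_* fromℕ K) (*-zeroˡ (T t))) (*-zeroˡ (fromℕ K)) ⟩
        0ℚ                   ≡⟨ *-zeroʳ (fromℕ L) ⟨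
        fromℕ L * 0ℚ         ≡⟨ cong (λ m → fromℕ L * fromℕ m) (1+b<c⇒[t+b]↓j≡0 1+b<c c+t≡1+j) ⟨
        fromℕ L * P t        ∎
        where
        1+b<c = ℕ.≰⇒> c≰1+b
        c+t≡1+j = trans c+t≡k (sym 1+j≡k)

      Σ-Z : Σ-binomial k (λ c _ → Z c) ≡ fromℕ (A C suc b)
      Σ-Z = begin
        Σ-binomial k (λ c _ → Z c)  ≡⟨ Σ-binomial-vandermonde k d δ ⟩
        Σ-binomial (k ℕ.+ d) δ      ≡⟨ cong (λ m → Σ-binomial m δ) k+d≡A ⟩
        Σ-binomial A δ              ≡⟨ Σ-binomial-𝟙 A 0 (suc b) ⟩
        fromℕ (A C suc b)           ∎
        where
        δ : ℕ → ℕ → ℚ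
        δ s _ = 𝟙[ s ≟ suc b ]

      Σ-[-1]^t*Z*T : Σ-binomial k (λ c t → [-1]^ t * (Z c * T t)) ≡ 0ℚ
      Σ-[-1]^t*Z*T = p*q≡0⇒p≡0 _ (fromℕ K) (begin
        Σ-binomial k (λ c t → [-1]^ t * (Z c * T t)) * fromℕ K
          ≡⟨ Σ-binomial-*ʳ k (fromℕ K) (λ c t → [-1]^ t * (Z c * T t)) ⟨
        Σ-binomial k (λ c t → [-1]^ t * (Z c * T t) * fromℕ K)
          ≡⟨ Σ-binomial-cong k term ⟩
        Σ-binomial k (λ _ t → fromℕ L * ([-1]^ t * P t))
          ≡⟨ Σ-binomial-*ˡ k (fromℕ L) (λ _ t → [-1]^ t * P t) ⟩
        fromℕ L * Σ-binomial k (λ _ t → [-1]^ t * P t)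
          ≡⟨ cong (fromℕ L *_) (Σ-binomial-alternating-↓ b (ℕ.≤-reflexive 1+j≡k)) ⟩
        fromℕ L * 0ℚ
          ≡⟨ *-zeroʳ (fromℕ L) ⟩
        0ℚ ∎)
        where
        instance
          _ = pos⇒nonZero (fromℕ K) {{fromℕ-pos K {{ℕ._!*_!≢0 b u}}}}
        term : ∀ c t → c ℕ.+ t ≡ k → [-1]^ t * (Z c * T t) * fromℕ K ≡ fromℕ L * ([-1]^ t * P t)
        term c t c+t≡k = begin
          [-1]^ t * (Z c * T t) * fromℕ K
            ≡⟨ solve 4 (λ s z x y → s :* (z :* x) :* y := s :* (z :* x :* y))
                       refl ([-1]^ t) (Z c) (T t) (fromℕ K) ⟩
          [-1]^ t * (Z c * T t * fromℕ K)
            ≡⟨ cong ([-1]^ t *_) (Z*T c t c+t≡k) ⟩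
          [-1]^ t * (fromℕ L * P t)
            ≡⟨ solve 3 (λ s l p → s :* (l :* p) := l :* (s :* p)) refl ([-1]^ t) (fromℕ L) (P t) ⟩
          fromℕ L * ([-1]^ t * P t)
            ∎

      weightAt-weight : weightAt weight f ≡ 1ℚ
      weightAt-weight = begin
        weightAt weight f
          ≡⟨ weightAt-≡ weight f ⟩
        sumSubsets n (λ Q → if does (f ⊆? Q) then weight Q else 0ℚ)
          ≡⟨ sumSubsets-⊇ e f (λ s m → 𝟙[ s ≟ q ] * X m) ⟩
        Σ-binomial k (λ c t → Σ-binomial d (λ a _ → 𝟙[ ∣ f ∣ ℕ.+ (c ℕ.+ a) ≟ q ] * X t))
          ≡⟨ Σ-binomial-cong k (λ c t _ → Σ-inner c t) ⟩
        Σ-binomial k (λ c t → Z c * X t)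
          ≡⟨ Σ-binomial-cong k (λ c t _ → split c t) ⟩
        Σ-binomial k (λ c t → α * Z c + - 1/ D * S c t)
          ≡⟨ Σ-binomial-+ k (λ c _ → α * Z c) (λ c t → - 1/ D * S c t) ⟩
        Σ-binomial k (λ c _ → α * Z c) + Σ-binomial k (λ c t → - 1/ D * S c t)
          ≡⟨ cong₂ _+_ (Σ-binomial-*ˡ k α (λ c _ → Z c)) (Σ-binomial-*ˡ k (- 1/ D) S) ⟩
        α * Σ-binomial k (λ c _ → Z c) + - 1/ D * Σ-binomial k S
          ≡⟨ cong₂ (λ x y → α * x + - 1/ D * y) Σ-Z Σ-[-1]^t*Z*T ⟩
        α * fromℕ (A C suc b) + - 1/ D * 0ℚ
          ≡⟨ solve 3 (λ i m a → i :* m :* a :+ (:- i) :* con 0ℚ := a :* m :* i)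
                     refl (1/ D) (fromℕ M) (fromℕ (A C suc b)) ⟩
        fromℕ (A C suc b) * fromℕ M * 1/ D
          ≡⟨ cong (_* 1/ D) (×1-homo-* (A C suc b) M) ⟨
        D * 1/ D
          ≡⟨ *-inverseʳ D ⟩
        1ℚ ∎
        where
        α = 1/ D * fromℕ M
        S : ℕ → ℕ → ℚ
        S c t = [-1]^ t * (Z c * T t)
        Σ-inner : ∀ c t → Σ-binomial d (λ a _ → 𝟙[ ∣ f ∣ ℕ.+ (c ℕ.+ a) ≟ q ] * X t) ≡ Z c * X t
        Σ-inner c t = trans
          (Σ-binomial-cong d λ a _ _ → cong (_* X t) (trans
            (cong₂ (λ m o → 𝟙[ m ℕ.+ (c ℕ.+ a) ≟ o ]) ∣f∣≡r (sym (ℕ.+-suc r b)))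
            (𝟙[m+n≟m+o]≡𝟙[n≟o] r)))
          (Σ-binomial-*ʳ d (X t) (λ a _ → 𝟙[ c ℕ.+ a ≟ suc b ]))
        split : ∀ c t → Z c * X t ≡ α * Z c + - 1/ D * S c t
        split c t = solve 5 (λ z m s x i → z :* ((m :- s :* x) :* i) := i :* m :* z :+ (:- i) :* (s :* (z :* x)))
                      refl (Z c) (fromℕ M) ([-1]^ t) (T t) (1/ D)

    K-minus-fractionalDecomposition : FractionalDecomposition r q (K-minus n r e)
    K-minus-fractionalDecomposition =
      weight , weight-nonNeg , weight≢0⇒IsCopy , λ f (∣f∣≡r , f≢e) → weightAt-weight f ∣f∣≡r f≢e

open import Data.Nat using (ℕ; _*_; _≤_; _<_; _+_; s≤s; z≤n)
open import Data.Nat.Properties using (m≤n⇒∃[o]m+o≡n; ≤-trans; n≤1+n; m≤m+n)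

theorem2p4 : (q r : ℕ) → 2 ≤ r → r < q → (e : Subset (r * q)) → ∣ e ∣ ≡ r →
    FractionalDecomposition {r * q} r q (K-minus (r * q) r e)
theorem2p4 q r@(suc (suc r-2)) (s≤s (s≤s z≤n)) r<q e ∣e∣≡r with m≤n⇒∃[o]m+o≡n r<q
... | b , refl = Decomposition.K-minus-fractionalDecomposition r b (suc r-2 * suc (r + b)) r+b≤u e ∣e∣≡r
  where
  -- r * q unfolds to q + (r − 1) * q.
  r+b≤u : r + b ≤ suc r-2 * suc (r + b)
  r+b≤u = ≤-trans (n≤1+n (r + b)) (m≤m+n (suc (r + b)) (r-2 * suc (r + b)))
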